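{- Let $\mathcal Q$ be a variety with free algebra $\mathbf F$ of countably infinite rank, and let $\mathsf{ASCC}(\mathcal Q)$ be the class of members of $\mathcal Q$ satisfying all $\mathcal Q$-active quasi-identities. Then for every subalgebra $\mathbf C$ of $\mathbf F$, $\mathsf{ASCC}(\mathcal Q)=\{\mathbf A\in\mathcal Q\mid \mathbf A\times\mathbf C\in\mathsf Q(\mathbf F)\}$. Moreover, a quasivariety $\mathcal R$ with $\mathsf Q(\mathbf F)\subseteq\mathcal R\subseteq\mathcal Q$ is almost structurally complete if and only if $\mathcal R\subseteq\mathsf{ASCC}(\mathcal Q)$.
   Context: A quasi-identity is $q=(\forall\bar x)[\varphi(\bar x)\to\psi(\bar x)]$ with $\varphi$ a finite conjunction of equations and $\psi$ an equation; $q^*=(\forall\bar x)\neg\varphi(\bar x)$. $\mathsf Q(\mathcal K)$ is the quasivariety generated by $\mathcal K$. A quasi-identity $q$ true in $\mathbf F$ is $\mathcal Q$-active if $q^*$ fails in $\mathbf F$. A quasivariety $\mathcal R$ is almost structurally complete if every quasi-identity which holds in the free algebra of countably infinite rank for $\mathcal R$ and is active (its $q^*$ fails in that free algebra) holds in $\mathcal R$; every $\mathcal R$ with $\mathsf Q(\mathbf F)\subseteq\mathcal R\subseteq\mathcal Q$ has $\mathbf F$ as its free algebra of countably infinite rank. -}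

module Defs where

open import Level using (Level; 0ℓ; _⊔_) renaming (suc to lsuc)
open import Data.Nat using (ℕ)
open import Data.Fin using (Fin)
open import Data.Product using (Σ; _×_; _,_; proj₁; proj₂; ∃)
open import Data.List using (List)
open import Data.List.Relation.Unary.All using (All)
open import Relation.Nullary using (¬_)
open import Relation.Binary using (Rel; IsEquivalence)

record Signature : Set₁ where
  field
    Op    : Set
    arity : Op → ℕ
open Signature public

data Term (σ : Signature) : Set where
  var : ℕ → Term σ
  op  : (f : Op σ) → (Fin (arity σ f) → Term σ) → Term σ

Equation : Signature → Set
Equation σ = Term σ × Term σ

sub : {σ : Signature} → (ℕ → Term σ) → Term σ → Term σ
sub θ (var x)   = θ x
sub θ (op f ts) = op f (λ i → sub θ (ts i))

-- Algebras (setoid-based, since Agda has no quotient types)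

record Algebra (σ : Signature) : Set₁ where
  field
    Carrier       : Set
    _≈_           : Rel Carrier 0ℓ
    isEquivalence : IsEquivalence _≈_
    ⟦_⟧           : (f : Op σ) → (Fin (arity σ f) → Carrier) → Carrier
    ⟦⟧-cong       : ∀ f {xs ys : Fin (arity σ f) → Carrier} →
                    (∀ i → xs i ≈ ys i) → ⟦ f ⟧ xs ≈ ⟦ f ⟧ ys

module _ {σ : Signature} (A : Algebra σ) where
  open Algebra A

  eval : Term σ → (ℕ → Carrier) → Carrier
  eval (var x)   ρ = ρ x
  eval (op f ts) ρ = ⟦ f ⟧ (λ i → eval (ts i) ρ)

  HoldsAt : (ℕ → Carrier) → Equation σ → Set
  HoldsAt ρ (s , t) = eval s ρ ≈ eval t ρ

_⊨ₑ_ : {σ : Signature} → Algebra σ → Equation σ → Set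
A ⊨ₑ e = ∀ ρ → HoldsAt A ρ e

record QuasiIdentity (σ : Signature) : Set where
  constructor _⇒_
  field
    premises   : List (Equation σ)
    conclusion : Equation σ
open QuasiIdentity public

_⊨q_ : {σ : Signature} → Algebra σ → QuasiIdentity σ → Set
A ⊨q q = ∀ ρ → All (HoldsAt A ρ) (premises q) → HoldsAt A ρ (conclusion q)

_⊨*_ : {σ : Signature} → Algebra σ → QuasiIdentity σ → Set
A ⊨* q = ∀ ρ → ¬ All (HoldsAt A ρ) (premises q)

-- q* fails in A : some assignment satisfies all premises φ(x̄)
-- (the positive/constructive form of ¬ (A ⊨* q))
StarFails : {σ : Signature} → Algebra σ → QuasiIdentity σ → Set
StarFails A q = ∃ λ ρ → All (HoldsAt A ρ) (premises q)

-- The variety Q = Mod(E) defined by a set E of identities, and its free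
-- algebra of countably infinite rank (terms over ℕ modulo E-derivability).

Mod : {σ : Signature} → (Equation σ → Set) → Algebra σ → Set
Mod E A = ∀ e → E e → A ⊨ₑ e

data _⊢_≈_ {σ : Signature} (E : Equation σ → Set) : Term σ → Term σ → Set where
  ax    : ∀ {l r} → E (l , r) → (θ : ℕ → Term σ) → E ⊢ sub θ l ≈ sub θ r
  refl  : ∀ {t} → E ⊢ t ≈ t
  sym   : ∀ {s t} → E ⊢ s ≈ t → E ⊢ t ≈ s
  trans : ∀ {s t u} → E ⊢ s ≈ t → E ⊢ t ≈ u → E ⊢ s ≈ u
  cong  : ∀ f {ts us : Fin (arity σ f) → Term σ} →
          (∀ i → E ⊢ ts i ≈ us i) → E ⊢ op f ts ≈ op f us

Free : {σ : Signature} → (Equation σ → Set) → Algebra σ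
Free {σ} E = record
  { Carrier       = Term σ
  ; _≈_           = E ⊢_≈_
  ; isEquivalence = record { refl = refl ; sym = sym ; trans = trans }
  ; ⟦_⟧           = op
  ; ⟦⟧-cong       = cong
  }

record Subuniverse {σ : Signature} (A : Algebra σ) : Set₁ where
  open Algebra A
  field
    member : Carrier → Set
    closed : ∀ f (xs : Fin (arity σ f) → Carrier) →
             (∀ i → member (xs i)) → member (⟦ f ⟧ xs)
open Subuniverse public

Nonempty : {σ : Signature} {A : Algebra σ} → Subuniverse A → Set
Nonempty S = ∃ λ a → member S a

SubAlg : {σ : Signature} (A : Algebra σ) → Subuniverse A → Algebra σ
SubAlg {σ} A S = record
  { Carrier       = Σ Carrier (member S)
  ; _≈_           = λ x y → proj₁ x ≈ proj₁ y
  ; isEquivalence = record { refl = IsEquivalence.refl isEquivalence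
                           ; sym = IsEquivalence.sym isEquivalence
                           ; trans = IsEquivalence.trans isEquivalence }
  ; ⟦_⟧           = λ f xs → ⟦ f ⟧ (λ i → proj₁ (xs i)) ,
                             closed S f (λ i → proj₁ (xs i)) (λ i → proj₂ (xs i))
  ; ⟦⟧-cong       = λ f eq → ⟦⟧-cong f eq
  }
  where open Algebra A

_×ᴬ_ : {σ : Signature} → Algebra σ → Algebra σ → Algebra σ
_×ᴬ_ {σ} A B = record
  { Carrier       = A.Carrier × B.Carrier
  ; _≈_           = λ x y → (proj₁ x A.≈ proj₁ y) × (proj₂ x B.≈ proj₂ y)
  ; isEquivalence = record
      { refl  = IsEquivalence.refl A.isEquivalence , IsEquivalence.refl B.isEquivalence
      ; sym   = λ p → IsEquivalence.sym A.isEquivalence (proj₁ p) ,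
                      IsEquivalence.sym B.isEquivalence (proj₂ p)
      ; trans = λ p q → IsEquivalence.trans A.isEquivalence (proj₁ p) (proj₁ q) ,
                        IsEquivalence.trans B.isEquivalence (proj₂ p) (proj₂ q) }
  ; ⟦_⟧           = λ f xs → A.⟦ f ⟧ (λ i → proj₁ (xs i)) , B.⟦ f ⟧ (λ i → proj₂ (xs i))
  ; ⟦⟧-cong       = λ f eq → A.⟦⟧-cong f (λ i → proj₁ (eq i)) , B.⟦⟧-cong f (λ i → proj₂ (eq i))
  }
  where
    module A = Algebra A
    module B = Algebra B

-- 𝖰(B): the quasivariety generated by B, i.e. the class of all algebras
-- satisfying every quasi-identity true in B  (= ISPP_U(B) by Mal'cev).
QGen : {σ : Signature} → Algebra σ → Algebra σ → Set
QGen B A = ∀ q → B ⊨q q → A ⊨q q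

IsQuasivariety : {σ : Signature} {ℓ : Level} → (Algebra σ → Set ℓ) → Set (lsuc 0ℓ ⊔ ℓ)
IsQuasivariety {σ} R =
  ∃ λ (Σq : QuasiIdentity σ → Set) →
    ∀ A → (R A → ∀ q → Σq q → A ⊨q q) × ((∀ q → Σq q → A ⊨q q) → R A)

_⊫_ : {σ : Signature} {ℓ : Level} → (Algebra σ → Set ℓ) → QuasiIdentity σ → Set (lsuc 0ℓ ⊔ ℓ)
R ⊫ q = ∀ A → R A → A ⊨q q

Active : {σ : Signature} → Algebra σ → QuasiIdentity σ → Set
Active F q = (F ⊨q q) × StarFails F q

ASCC : {σ : Signature} → (Equation σ → Set) → Algebra σ → Set
ASCC E A = Mod E A × (∀ q → Active (Free E) q → A ⊨q q)

-- R is almost structurally complete, where F is the free algebra of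
-- countably infinite rank for R
AlmostStructurallyComplete : {σ : Signature} {ℓ : Level} →
  (F : Algebra σ) → (Algebra σ → Set ℓ) → Set (lsuc 0ℓ ⊔ ℓ)
AlmostStructurallyComplete F R = ∀ q → F ⊨q q → StarFails F q → R ⊫ q

-- A × B satisfies q when B does and A does in case the premises of q are
-- solvable in B; conversely A satisfies q when A × B does and the premises are
-- solvable in B. Premises are solvable in C iff they are in F: a solution in C
-- is one in F, and substituting a fixed element of C for every variable, an
-- endomorphism of F, moves a solution in F into C. As C satisfies every
-- quasi-identity true in F, A satisfies the active quasi-identities iff A × C
-- satisfies everything true in F.
module Submission where

open import Defs
open import Level using (Level)
open import Data.Nat using (ℕ)
open import Function using (_∘_; const)
open import Function.Bundles using (_⇔_; mk⇔)
open import Data.Product using (_×_; _,_; proj₁; proj₂)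
open import Data.List.Relation.Unary.All as All using (All)
open import Relation.Binary using (IsEquivalence)

module _ {σ : Signature} where

  record Homomorphism (A B : Algebra σ) : Set where
    private
      module A = Algebra A
      module B = Algebra B
    field
      apply      : A.Carrier → B.Carrier
      apply-cong : ∀ {x y} → x A.≈ y → apply x B.≈ apply y
      homo       : ∀ f xs → apply (A.⟦ f ⟧ xs) B.≈ B.⟦ f ⟧ (apply ∘ xs)

  module _ {A B : Algebra σ} (h : Homomorphism A B) where
    private
      module A = Algebra A
      module B = Algebra B
      module B≈ = IsEquivalence B.isEquivalence
    open Homomorphism h

    eval-homo : ∀ t ρ → apply (eval A t ρ) B.≈ eval B t (apply ∘ ρ)
    eval-homo (var x)   ρ = B≈.refl
    eval-homo (op f ts) ρ = B≈.trans (homo f _) (B.⟦⟧-cong f (λ i → eval-homo (ts i) ρ))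

    HoldsAt-homo : ∀ ρ e → HoldsAt A ρ e → HoldsAt B (apply ∘ ρ) e
    HoldsAt-homo ρ (s , t) s≈t =
      B≈.trans (B≈.sym (eval-homo s ρ)) (B≈.trans (apply-cong s≈t) (eval-homo t ρ))

    HoldsAt-reflect : (∀ {x y} → apply x B.≈ apply y → x A.≈ y) →
                      ∀ ρ e → HoldsAt B (apply ∘ ρ) e → HoldsAt A ρ e
    HoldsAt-reflect reflects ρ (s , t) s≈t =
      reflects (B≈.trans (eval-homo s ρ) (B≈.trans s≈t (B≈.sym (eval-homo t ρ))))

  module _ (A B : Algebra σ) where
    private
      module A = Algebra A
      module B = Algebra B

    π₁ : Homomorphism (A ×ᴬ B) A
    π₁ = record { apply = proj₁ ; apply-cong = proj₁
                ; homo = λ _ _ → IsEquivalence.refl A.isEquivalence }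

    π₂ : Homomorphism (A ×ᴬ B) B
    π₂ = record { apply = proj₂ ; apply-cong = proj₂
                ; homo = λ _ _ → IsEquivalence.refl B.isEquivalence }

    HoldsAt-×⁻ : ∀ ρ e → HoldsAt (A ×ᴬ B) ρ e →
                 HoldsAt A (proj₁ ∘ ρ) e × HoldsAt B (proj₂ ∘ ρ) e
    HoldsAt-×⁻ ρ e holds = HoldsAt-homo π₁ ρ e holds , HoldsAt-homo π₂ ρ e holds

    HoldsAt-×⁺ : ∀ ρ e → HoldsAt A (proj₁ ∘ ρ) e → HoldsAt B (proj₂ ∘ ρ) e →
                 HoldsAt (A ×ᴬ B) ρ e
    HoldsAt-×⁺ ρ (s , t) s≈tᴬ s≈tᴮ =
      A×B≈.trans (eval-× s) (A×B≈.trans (s≈tᴬ , s≈tᴮ) (A×B≈.sym (eval-× t)))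
      where
      module A×B≈ = IsEquivalence (Algebra.isEquivalence (A ×ᴬ B))
      eval-× : ∀ u → Algebra._≈_ (A ×ᴬ B) (eval (A ×ᴬ B) u ρ)
                                        (eval A u (proj₁ ∘ ρ) , eval B u (proj₂ ∘ ρ))
      eval-× u = eval-homo π₁ u ρ , eval-homo π₂ u ρ

    ⊨q-× : ∀ q → (StarFails B q → A ⊨q q) → B ⊨q q → (A ×ᴬ B) ⊨q q
    ⊨q-× q A⊨q B⊨q ρ φ =
      HoldsAt-×⁺ ρ (conclusion q)
        (A⊨q (proj₂ ∘ ρ , φᴮ) (proj₁ ∘ ρ) (All.map proj₁ split))
        (B⊨q (proj₂ ∘ ρ) φᴮ)
      where
      split : All (λ e → HoldsAt A (proj₁ ∘ ρ) e × HoldsAt B (proj₂ ∘ ρ) e) (premises q)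
      split = All.map (λ {e} → HoldsAt-×⁻ ρ e) φ
      φᴮ : All (HoldsAt B (proj₂ ∘ ρ)) (premises q)
      φᴮ = All.map proj₂ split

    ⊨q-×-cancelʳ : ∀ q → (A ×ᴬ B) ⊨q q → StarFails B q → A ⊨q q
    ⊨q-×-cancelʳ q A×B⊨q (ρᴮ , φᴮ) ρ φᴬ =
      proj₁ (HoldsAt-×⁻ paired (conclusion q) (A×B⊨q paired φ))
      where
      paired : ℕ → A.Carrier × B.Carrier
      paired x = ρ x , ρᴮ x
      φ : All (HoldsAt (A ×ᴬ B) paired) (premises q)
      φ = All.zipWith (λ {e} (hᴬ , hᴮ) → HoldsAt-×⁺ paired e hᴬ hᴮ) (φᴬ , φᴮ)

  StarFails-homo : {A B : Algebra σ} (h : Homomorphism A B) →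
                   ∀ q → StarFails A q → StarFails B q
  StarFails-homo h q (ρ , φ) =
    Homomorphism.apply h ∘ ρ , All.map (λ {e} → HoldsAt-homo h ρ e) φ

  module _ (A : Algebra σ) (S : Subuniverse A) where

    inclusion : Homomorphism (SubAlg A S) A
    inclusion = record { apply = proj₁ ; apply-cong = λ x≈y → x≈y
                       ; homo = λ _ _ → IsEquivalence.refl (Algebra.isEquivalence A) }

    HoldsAt-SubAlg : ∀ ρ e → HoldsAt A (proj₁ ∘ ρ) e → HoldsAt (SubAlg A S) ρ e
    HoldsAt-SubAlg = HoldsAt-reflect inclusion (λ x≈y → x≈y)

    ⊨q-SubAlg : ∀ q → A ⊨q q → SubAlg A S ⊨q q
    ⊨q-SubAlg q A⊨q ρ φ =
      HoldsAt-SubAlg ρ (conclusion q)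
        (A⊨q (proj₁ ∘ ρ) (All.map (λ {e} → HoldsAt-homo inclusion ρ e) φ))

  module _ (E : Equation σ → Set) where

    sub-∘ : ∀ θ θ′ t → E ⊢ sub θ (sub θ′ t) ≈ sub (sub θ ∘ θ′) t
    sub-∘ θ θ′ (var x)   = refl
    sub-∘ θ θ′ (op f ts) = cong f (λ i → sub-∘ θ θ′ (ts i))

    ⊢-sub : ∀ θ {s t} → E ⊢ s ≈ t → E ⊢ sub θ s ≈ sub θ t
    ⊢-sub θ (ax {l} {r} l≈r θ′) =
      trans (sub-∘ θ θ′ l) (trans (ax l≈r (sub θ ∘ θ′)) (sym (sub-∘ θ θ′ r)))
    ⊢-sub θ refl          = refl
    ⊢-sub θ (sym p)       = sym (⊢-sub θ p)
    ⊢-sub θ (trans p q)   = trans (⊢-sub θ p) (⊢-sub θ q)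
    ⊢-sub θ (cong f ps)   = cong f (λ i → ⊢-sub θ (ps i))

    substitution : (ℕ → Term σ) → Homomorphism (Free E) (Free E)
    substitution θ = record { apply = sub θ ; apply-cong = ⊢-sub θ ; homo = λ _ _ → refl }

    member-sub : (C : Subuniverse (Free E)) (θ : ℕ → Term σ) →
                 (∀ x → member C (θ x)) → ∀ t → member C (sub θ t)
    member-sub C θ θ∈C (var x)   = θ∈C x
    member-sub C θ θ∈C (op f ts) = closed C f (sub θ ∘ ts) (member-sub C θ θ∈C ∘ ts)

    StarFails-SubAlg : (C : Subuniverse (Free E)) → Nonempty C →
                       ∀ q → StarFails (Free E) q → StarFails (SubAlg (Free E) C) q
    StarFails-SubAlg C (c , c∈C) q (ρ , φ) =
      (λ x → sub (const c) (ρ x) , member-sub C (const c) (const c∈C) (ρ x)) ,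
      All.map (λ {e} → HoldsAt-SubAlg (Free E) C _ e
                       ∘ HoldsAt-homo (substitution (const c)) ρ e) φ

ASCC⇔QGen-×SubAlg : {σ : Signature} (E : Equation σ → Set) →
  (C : Subuniverse (Free E)) → Nonempty C →
  (A : Algebra σ) → ASCC E A ⇔ (Mod E A × QGen (Free E) (A ×ᴬ SubAlg (Free E) C))
ASCC⇔QGen-×SubAlg {σ} E C C≠∅ A = mk⇔
  (λ (A⊨E , A⊨active) → A⊨E , λ q F⊨q →
    ⊨q-× A C′ q (λ q*-fails → A⊨active q (F⊨q , StarFails-homo (inclusion F C) q q*-fails))
                (⊨q-SubAlg F C q F⊨q))
  (λ (A⊨E , A×C⊨F) → A⊨E , λ q (F⊨q , q*-fails) →
    ⊨q-×-cancelʳ A C′ q (A×C⊨F q F⊨q) (StarFails-SubAlg E C C≠∅ q q*-fails))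
  where
  F C′ : Algebra σ
  F  = Free E
  C′ = SubAlg F C

AlmostStructurallyComplete⇔⊆ASCC : {ℓ : Level} {σ : Signature} (E : Equation σ → Set) →
  (R : Algebra σ → Set ℓ) → (∀ A → R A → Mod E A) →
  AlmostStructurallyComplete (Free E) R ⇔ (∀ A → R A → ASCC E A)
AlmostStructurallyComplete⇔⊆ASCC E R R⊆Mod = mk⇔
  (λ asc A RA → R⊆Mod A RA , λ q (F⊨q , q*-fails) → asc q F⊨q q*-fails A RA)
  (λ R⊆ASCC q F⊨q q*-fails A RA → proj₂ (R⊆ASCC A RA) q (F⊨q , q*-fails))

proposition4p1 : {ℓ : Level} (σ : Signature) (E : Equation σ → Set) →
    ((C : Subuniverse (Free E)) → Nonempty C →
      (A : Algebra σ) → ASCC E A ⇔ (Mod E A × QGen (Free E) (A ×ᴬ SubAlg (Free E) C)))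
    ×
    ((R : Algebra σ → Set ℓ) → IsQuasivariety R →
      (∀ A → QGen (Free E) A → R A) → (∀ A → R A → Mod E A) →
      AlmostStructurallyComplete (Free E) R ⇔ (∀ A → R A → ASCC E A))
proposition4p1 σ E =
  ASCC⇔QGen-×SubAlg E ,
  λ R _ _ R⊆Mod → AlmostStructurallyComplete⇔⊆ASCC E R R⊆Mod
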